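{- Let $t\geq 3$ be an integer and suppose that every $PG(t-2,2)$-free matroid $M'$ with $|M'|>(1-3\cdot 2^{ -(t-1)})2^{r(M')}$ satisfies $\chi(M')\in\{t-2,t-1\}$. Let $M$ be a $PG(t-1,2)$-free matroid with $|M|>(1-3\cdot 2^{ -t})2^{r(M)}$ and $\chi(M)>t$, and set $Y=\mathbb{F}_2^{r(M)}\setminus E(M)$. Then for every linear subspace $H$ of $\mathbb{F}_2^{r(M)}$: (i) if $H$ has codimension $1$, then $|Y\cap H|<2\cdot 2^{r(M)-t}$; (ii) if $H$ has codimension $2$, then $|Y\cap H|<\frac32\cdot 2^{r(M)-t}$; (iii) if $H$ has codimension $3$, then $|Y\cap H|<\frac54\cdot 2^{r(M)-t}$.
   Context: A matroid $M$ means a simple binary matroid, represented by an integer $r(M)\geq 0$ (its rank) and a set $E(M)\subseteq \mathbb{F}_2^{r(M)}\setminus\{0\}$ that spans $\mathbb{F}_2^{r(M)}$; $|M|:=|E(M)|$. The critical number $\chi(M)$ is the smallest $k$ such that some subspace of $\mathbb{F}_2^{r(M)}$ of codimension $k$ is disjoint from $E(M)$. A matroid $M$ contains a matroid $N$ if there is an injective linear map $\iota:\mathbb{F}_2^{r(N)}\to\mathbb{F}_2^{r(M)}$ with $\iota(E(N))\subseteq E(M)$; $M$ is $N$-free if it does not contain $N$. The projective geometry $PG(s-1,2)$ is the matroid of rank $s$ with edge set $\mathbb{F}_2^s\setminus\{0\}$. -}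

module Defs where

open import Data.Bool using (Bool; true; false; not; _xor_; _∧_)
open import Data.Nat using (ℕ; zero; suc; _+_; _*_; _^_; _<_)
open import Data.Vec using (Vec; []; _∷_; replicate; zipWith)
open import Data.List using (List; []; _∷_; _++_; map)
open import Data.List.Relation.Unary.All using (All; []; _∷_)
open import Data.Product using (Σ; ∃; _×_; _,_)
open import Relation.Binary.PropositionalEquality using (_≡_; refl; sym; cong)
open import Relation.Nullary using (¬_)

-- The vector space F₂^r, elements are Vec Bool r (true = 1).

V : ℕ → Set
V r = Vec Bool r

zeroV : ∀ {r} → V r
zeroV = replicate _ false

infixl 6 _⊕_
_⊕_ : ∀ {r} → V r → V r → V r
_⊕_ = zipWith _xor_

isZero : ∀ {r} → V r → Bool
isZero []         = true
isZero (x ∷ v)    = not x ∧ isZero v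

sumV : ∀ {r} → List (V r) → V r
sumV []       = zeroV
sumV (x ∷ xs) = x ⊕ sumV xs

allVecs : (r : ℕ) → List (V r)
allVecs zero    = [] ∷ []
allVecs (suc r) = map (false ∷_) (allVecs r) ++ map (true ∷_) (allVecs r)

countB : ∀ {A : Set} → (A → Bool) → List A → ℕ
countB P []       = 0
countB P (x ∷ xs) with P x
... | true  = suc (countB P xs)
... | false = countB P xs

card : ∀ {r} → (V r → Bool) → ℕ
card {r} S = countB S (allVecs r)

lincomb : ∀ {r d} → Vec (V r) d → Vec Bool d → V r
lincomb []       []            = zeroV
lincomb (b ∷ bs) (true  ∷ cs)  = b ⊕ lincomb bs cs
lincomb (b ∷ bs) (false ∷ cs)  = lincomb bs cs

LinIndep : ∀ {r d} → Vec (V r) d → Set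
LinIndep {d = d} bs = ∀ (c : Vec Bool d) → lincomb bs c ≡ zeroV → c ≡ replicate d false

IsSubspace : ∀ {r} → (V r → Bool) → Set
IsSubspace H = (H zeroV ≡ true) × (∀ x y → H x ≡ true → H y ≡ true → H (x ⊕ y) ≡ true)

HasDim : ∀ {r} → (V r → Bool) → ℕ → Set
HasDim {r} H d = Σ (Vec (V r) d) λ bs →
  LinIndep bs × (∀ v → H v ≡ true → ∃ λ c → lincomb bs c ≡ v)
              × (∀ c → H (lincomb bs c) ≡ true)

HasCodim : ∀ {r} → (V r → Bool) → ℕ → Set
HasCodim {r} H k = ∃ λ d → (d + k ≡ r) × HasDim H d

-- Simple binary matroids

record Matroid : Set where
  field
    rank    : ℕ
    E       : V rank → Bool
    nonzero : E zeroV ≡ false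
    spans   : ∀ (v : V rank) → ∃ λ (xs : List (V rank)) →
                All (λ x → E x ≡ true) xs × sumV xs ≡ v
open Matroid public

size : Matroid → ℕ
size M = card (E M)

AvoidsAtCodim : Matroid → ℕ → Set
AvoidsAtCodim M k = Σ (V (rank M) → Bool) λ H →
  IsSubspace H × HasCodim H k × (∀ v → H v ≡ true → E M v ≡ false)

IsCriticalNumber : Matroid → ℕ → Set
IsCriticalNumber M c = AvoidsAtCodim M c × (∀ k → k < c → ¬ AvoidsAtCodim M k)

Contains : Matroid → Matroid → Set
Contains M N = Σ (V (rank N) → V (rank M)) λ ι →
    (∀ x y → ι (x ⊕ y) ≡ ι x ⊕ ι y)
  × (∀ x y → ι x ≡ ι y → x ≡ y)
  × (∀ x → E N x ≡ true → E M (ι x) ≡ true)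

-- projective geometry PG(s-1,2): rank s, all nonzero vectors
private
  isZero-zeroV : ∀ r → isZero (replicate r false) ≡ true
  isZero-zeroV zero    = refl
  isZero-zeroV (suc r) = isZero-zeroV r

  zipxor-zero : ∀ {r} (v : V r) → v ⊕ zeroV ≡ v
  zipxor-zero []            = refl
  zipxor-zero (true ∷ v)  rewrite zipxor-zero v = refl
  zipxor-zero (false ∷ v) rewrite zipxor-zero v = refl

  isZero-sound : ∀ {r} (v : V r) → isZero v ≡ true → v ≡ zeroV
  isZero-sound []          _ = refl
  isZero-sound (false ∷ v) p rewrite isZero-sound v p = refl
  isZero-sound (true ∷ v)  ()

  pgSpans : ∀ s (v : V s) → ∃ λ (xs : List (V s)) →
              All (λ x → not (isZero x) ≡ true) xs × sumV xs ≡ v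
  pgSpans s v with isZero v in eq
  ... | true  = [] , [] , sym (isZero-sound v eq)
  ... | false = (v ∷ []) , (helper ∷ []) , zipxor-zero v
    where
      helper : not (isZero v) ≡ true
      helper rewrite eq = refl

PG : ℕ → Matroid
PG s = record
  { rank    = s
  ; E       = λ v → not (isZero v)
  ; nonzero = cong not (isZero-zeroV s)
  ; spans   = pgSpans s
  }

-- Write Y for the complement of E(M) and T = 2^t, so that the density hypothesis reads
-- T·|Y| < 3·2^r.  The key step is that every hyperplane H₁ misses at least 2^r / T points of Y.
-- Otherwise let M′ be the restriction of M to the span W of E(M) ∩ H₁.  The points of H₁ ∖ W
-- lie in Y, so M′ is again dense.  A copy of PG(t-2,2) in M′ would force every coset of it
-- off H₁ to meet Y (a coset inside M would span a PG(t-1,2)), and these few cosets cannot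
-- cover the complement of H₁; so M′ is PG(t-2,2)-free and χ(M′) ≤ t-1 by hypothesis.  An
-- avoiding subspace of M′ plus a complement of W in H₁ then avoids M with codimension ≤ t,
-- contradicting χ(M) > t.
-- For H of codimension j, each point outside H lies off exactly 2^(j-1) of the 2^j - 1
-- hyperplanes through H, whence 2^(j-1)·|Y ∖ H| ≥ (2^j - 1)·2^r / T.  Together with the
-- density bound this gives 2^(j-1)·T·|Y ∩ H| < (2^(j-1) + 1)·2^r, which is (i)–(iii) for
-- j = 1, 2, 3.

module Submission where

open import Defs
open import Data.Nat using (ℕ; zero; suc; _+_; _*_; _^_; _<_; _≤_; _∸_; z≤n; s≤s; _≤?_; NonZero)
open import Data.Nat.Tactic.RingSolver using (solve-∀)
open import Data.Nat.Properties
open import Data.Nat.Induction using (<-rec)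
open import Data.Nat.ListAction using (sum)
open import Data.Bool using (Bool; true; false; not; _∧_; _∨_; _xor_; if_then_else_)
open import Data.Bool.Properties
  using (∨-zeroʳ; ∧-zeroʳ; ∧-comm; xor-comm; xor-assoc; xor-identityˡ; xor-identityʳ; xor-same;
         ∧-distribˡ-xor; ∧-distribʳ-xor; xor-∧-commutativeRing; T-≡; not-injective; not-¬)
open import Algebra.Bundles using (CommutativeRing)
open import Algebra.Properties.CommutativeSemigroup
  (CommutativeRing.+-commutativeSemigroup xor-∧-commutativeRing) using () renaming (interchange to xor-interchange)
open import Algebra.Properties.CommutativeSemigroup +-commutativeSemigroup
  using () renaming (interchange to +-interchange)
open import Data.Product using (Σ; ∃; _×_; _,_; proj₁; proj₂)
open import Data.Sum using (_⊎_; inj₁; inj₂)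
open import Data.Empty using (⊥-elim)
open import Data.Vec using (Vec; []; _∷_; take; drop; splitAt)
  renaming (_++_ to _++ᵛ_; map to mapᵛ)
open import Data.Vec.Properties
  using (zipWith-comm; zipWith-assoc; zipWith-identityˡ; zipWith-identityʳ; ∷-injectiveʳ;
         ++-injectiveˡ; ++-injectiveʳ; take-zipWith; take++drop≡id)
open import Data.Vec.Relation.Unary.All using ([]; _∷_) renaming (All to AllV)
import Data.Vec.Relation.Unary.All as AllV
import Data.Vec.Relation.Unary.All.Properties as AllV
open import Data.List using (List; []; _∷_; _++_; map; length; filterᵇ; concatMap)
open import Data.List.Properties using (length-map; length-++; length-removeAt′; map-cong)
open import Data.List.Relation.Unary.All using (All; []; _∷_)
open import Data.List.Relation.Unary.Any as Any using (here; there)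
import Data.List.Relation.Unary.All as All
import Data.List.Relation.Unary.All.Properties as All
open import Data.List.Membership.Propositional using (_∈_; lose)
open import Data.List.Membership.Propositional.Properties
  using (∈-map⁺; ∈-map⁻; ∈-++⁺ˡ; ∈-++⁺ʳ; ∈-filter⁺; ∈-filter⁻; ∈-concatMap⁺)
open import Data.List.Relation.Unary.Unique.Propositional using (Unique)
open import Data.List.Relation.Unary.AllPairs using ([]; _∷_)
import Data.List.Relation.Unary.Unique.Propositional.Properties as Unique
open import Relation.Nullary using (¬_; yes; no)
open import Relation.Nullary.Decidable using (T?)
open import Function using (_∘_; id)
open import Function.Bundles using (Equivalence)
open import Relation.Binary.PropositionalEquality

-- Booleans and vectors over F₂

∧-≡true : ∀ a b → a ∧ b ≡ true → a ≡ true × b ≡ true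
∧-≡true true true _ = refl , refl

∧-intro : ∀ {a b} → a ≡ true → b ≡ true → a ∧ b ≡ true
∧-intro refl refl = refl

not-≡true : ∀ {a} → not a ≡ true → a ≡ false
not-≡true {false} _ = refl

take-++ : ∀ {A : Set} {m n} (xs : Vec A m) (ys : Vec A n) → take m (xs ++ᵛ ys) ≡ xs
take-++ {m = m} xs ys = ++-injectiveˡ (take m (xs ++ᵛ ys)) xs (take++drop≡id m (xs ++ᵛ ys))

Bool-≡ : ∀ {a b} → (a ≡ true → b ≡ true) → (b ≡ true → a ≡ true) → a ≡ b
Bool-≡ {true}  {b}     a⇒b _   = sym (a⇒b refl)
Bool-≡ {false} {false} _   _   = refl
Bool-≡ {false} {true}  _   b⇒a = b⇒a refl

⊕-comm : ∀ {n} (x y : V n) → x ⊕ y ≡ y ⊕ x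
⊕-comm = zipWith-comm xor-comm

⊕-assoc : ∀ {n} (x y z : V n) → (x ⊕ y) ⊕ z ≡ x ⊕ (y ⊕ z)
⊕-assoc = zipWith-assoc xor-assoc

⊕-identityˡ : ∀ {n} (x : V n) → zeroV ⊕ x ≡ x
⊕-identityˡ = zipWith-identityˡ xor-identityˡ

⊕-identityʳ : ∀ {n} (x : V n) → x ⊕ zeroV ≡ x
⊕-identityʳ = zipWith-identityʳ xor-identityʳ

⊕-self : ∀ {n} (x : V n) → x ⊕ x ≡ zeroV
⊕-self []      = refl
⊕-self (a ∷ x) = cong₂ _∷_ (xor-same a) (⊕-self x)

⊕-cancelʳ : ∀ {n} (x y : V n) → (x ⊕ y) ⊕ y ≡ x
⊕-cancelʳ x y = begin
  (x ⊕ y) ⊕ y  ≡⟨ ⊕-assoc x y y ⟩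
  x ⊕ (y ⊕ y)  ≡⟨ cong (x ⊕_) (⊕-self y) ⟩
  x ⊕ zeroV    ≡⟨ ⊕-identityʳ x ⟩
  x            ∎
  where open ≡-Reasoning

⊕-cancelˡ : ∀ {n} (x y : V n) → x ⊕ (x ⊕ y) ≡ y
⊕-cancelˡ x y = begin
  x ⊕ (x ⊕ y)  ≡⟨ ⊕-assoc x x y ⟨
  (x ⊕ x) ⊕ y  ≡⟨ cong (_⊕ y) (⊕-self x) ⟩
  zeroV ⊕ y    ≡⟨ ⊕-identityˡ y ⟩
  y            ∎
  where open ≡-Reasoning

x⊕y≡0⇒x≡y : ∀ {n} {x y : V n} → x ⊕ y ≡ zeroV → x ≡ y
x⊕y≡0⇒x≡y {x = x} {y} eq = trans (sym (⊕-cancelʳ x y)) (trans (cong (_⊕ y) eq) (⊕-identityˡ y))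

⊕-injectiveˡ : ∀ {n} (a : V n) {x y : V n} → a ⊕ x ≡ a ⊕ y → x ≡ y
⊕-injectiveˡ a {x} {y} eq = trans (sym (⊕-cancelˡ a x)) (trans (cong (a ⊕_) eq) (⊕-cancelˡ a y))

⊕-interchange : ∀ {n} (x y z w : V n) → (x ⊕ y) ⊕ (z ⊕ w) ≡ (x ⊕ z) ⊕ (y ⊕ w)
⊕-interchange x y z w = begin
  (x ⊕ y) ⊕ (z ⊕ w)  ≡⟨ ⊕-assoc x y (z ⊕ w) ⟩
  x ⊕ (y ⊕ (z ⊕ w))  ≡⟨ cong (x ⊕_) (sym (⊕-assoc y z w)) ⟩
  x ⊕ ((y ⊕ z) ⊕ w)  ≡⟨ cong (λ u → x ⊕ (u ⊕ w)) (⊕-comm y z) ⟩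
  x ⊕ ((z ⊕ y) ⊕ w)  ≡⟨ cong (x ⊕_) (⊕-assoc z y w) ⟩
  x ⊕ (z ⊕ (y ⊕ w))  ≡⟨ sym (⊕-assoc x z (y ⊕ w)) ⟩
  (x ⊕ z) ⊕ (y ⊕ w)  ∎
  where open ≡-Reasoning

zeroV-++ : ∀ m n → zeroV {m} ++ᵛ zeroV {n} ≡ zeroV
zeroV-++ zero    n = refl
zeroV-++ (suc m) n = cong (false ∷_) (zeroV-++ m n)

++≡zeroV : ∀ {m n} (a : V m) (b : V n) → a ++ᵛ b ≡ zeroV → a ≡ zeroV × b ≡ zeroV
++≡zeroV {m} {n} a b eq =
  ++-injectiveˡ a zeroV eq′ , ++-injectiveʳ a zeroV eq′
  where
  eq′ : a ++ᵛ b ≡ zeroV {m} ++ᵛ zeroV {n}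
  eq′ = trans eq (sym (zeroV-++ m n))

isZero⇒≡zeroV : ∀ {n} (v : V n) → isZero v ≡ true → v ≡ zeroV
isZero⇒≡zeroV []          _  = refl
isZero⇒≡zeroV (false ∷ v) eq = cong (false ∷_) (isZero⇒≡zeroV v eq)

isZero-zeroV : ∀ n → isZero (zeroV {n}) ≡ true
isZero-zeroV zero    = refl
isZero-zeroV (suc n) = isZero-zeroV n

IsLinear : ∀ {m n} → (V m → V n) → Set
IsLinear f = ∀ x y → f (x ⊕ y) ≡ f x ⊕ f y

linear-zero : ∀ {m n} {f : V m → V n} → IsLinear f → f zeroV ≡ zeroV
linear-zero {f = f} lin = ⊕-injectiveˡ (f zeroV) (begin
  f zeroV ⊕ f zeroV   ≡⟨ lin zeroV zeroV ⟨
  f (zeroV ⊕ zeroV)   ≡⟨ cong f (⊕-identityˡ zeroV) ⟩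
  f zeroV             ≡⟨ ⊕-identityʳ (f zeroV) ⟨
  f zeroV ⊕ zeroV     ∎)
  where open ≡-Reasoning

-- Counting

search : ∀ {n} (P : V n → Bool) → (∃ λ v → P v ≡ true) ⊎ (∀ v → P v ≡ false)
search {zero} P with P [] in eq
... | true  = inj₁ ([] , eq)
... | false = inj₂ λ { [] → eq }
search {suc n} P with search (λ v → P (false ∷ v)) | search (λ v → P (true ∷ v))
... | inj₁ (v , p) | _            = inj₁ (false ∷ v , p)
... | inj₂ _       | inj₁ (v , p) = inj₁ (true ∷ v , p)
... | inj₂ none₀   | inj₂ none₁   = inj₂ λ { (false ∷ v) → none₀ v ; (true ∷ v) → none₁ v }

∈-allVecs : ∀ {n} (v : V n) → v ∈ allVecs n
∈-allVecs []                = here refl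
∈-allVecs {suc n} (false ∷ v) = ∈-++⁺ˡ (∈-map⁺ (false ∷_) (∈-allVecs v))
∈-allVecs {suc n} (true ∷ v)  = ∈-++⁺ʳ (map (false ∷_) (allVecs n)) (∈-map⁺ (true ∷_) (∈-allVecs v))

allVecs-unique : ∀ n → Unique (allVecs n)
allVecs-unique zero    = [] ∷ []
allVecs-unique (suc n) =
  Unique.++⁺ (Unique.map⁺ ∷-injectiveʳ (allVecs-unique n)) (Unique.map⁺ ∷-injectiveʳ (allVecs-unique n)) disjoint
  where
  disjoint : ∀ {v} → ¬ (v ∈ map (false ∷_) (allVecs n) × v ∈ map (true ∷_) (allVecs n))
  disjoint (p , q) with ∈-map⁻ (false ∷_) p | ∈-map⁻ (true ∷_) q
  ... | _ , _ , refl | _ , _ , ()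

length-allVecs : ∀ n → length (allVecs n) ≡ 2 ^ n
length-allVecs zero    = refl
length-allVecs (suc n) = begin
  length (map (false ∷_) (allVecs n) ++ map (true ∷_) (allVecs n))
    ≡⟨ length-++ (map (false ∷_) (allVecs n)) ⟩
  length (map (false ∷_) (allVecs n)) + length (map (true ∷_) (allVecs n))
    ≡⟨ cong₂ _+_ (length-map _ (allVecs n)) (length-map _ (allVecs n)) ⟩
  length (allVecs n) + length (allVecs n)
    ≡⟨ cong (λ k → k + k) (length-allVecs n) ⟩
  2 ^ n + 2 ^ n
    ≡⟨ cong (2 ^ n +_) (sym (+-identityʳ (2 ^ n))) ⟩
  2 ^ suc n ∎
  where open ≡-Reasoning

countB≡length-filterᵇ : ∀ {A : Set} (P : A → Bool) (xs : List A) → countB P xs ≡ length (filterᵇ P xs)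
countB≡length-filterᵇ P []       = refl
countB≡length-filterᵇ P (x ∷ xs) with P x
... | true  = cong suc (countB≡length-filterᵇ P xs)
... | false = countB≡length-filterᵇ P xs

countB-complement : ∀ {A : Set} (P : A → Bool) (xs : List A) →
                    countB P xs + countB (λ x → not (P x)) xs ≡ length xs
countB-complement P []       = refl
countB-complement P (x ∷ xs) with P x
... | true  = cong suc (countB-complement P xs)
... | false = trans (+-suc _ _) (cong suc (countB-complement P xs))

countB-split : ∀ {A : Set} (P Q : A → Bool) (xs : List A) →
               countB P xs ≡ countB (λ x → P x ∧ Q x) xs + countB (λ x → P x ∧ not (Q x)) xs
countB-split P Q []       = refl
countB-split P Q (x ∷ xs) with P x | Q x
... | true  | true  = cong suc (countB-split P Q xs)
... | true  | false = trans (cong suc (countB-split P Q xs)) (sym (+-suc _ _))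
... | false | _     = countB-split P Q xs

countB-cong : ∀ {A : Set} {P Q : A → Bool} → (∀ x → P x ≡ Q x) → ∀ xs → countB P xs ≡ countB Q xs
countB-cong P≗Q []       = refl
countB-cong {P = P} {Q} P≗Q (x ∷ xs) with P x | Q x | P≗Q x
... | true  | true  | _ = cong suc (countB-cong P≗Q xs)
... | false | false | _ = countB-cong P≗Q xs

Unique⇒length≤ : ∀ {A : Set} {xs ys : List A} → Unique xs → (∀ {z} → z ∈ xs → z ∈ ys) → length xs ≤ length ys
Unique⇒length≤ {xs = []}     _                 _   = z≤n
Unique⇒length≤ {A} {xs = x ∷ xs} {ys} (x∉xs ∷ uxs) xs⊆ys =
  subst (suc (length xs) ≤_) (sym (length-removeAt′ ys (Any.index x∈ys)))
    (s≤s (Unique⇒length≤ uxs λ z∈xs → ∈-─ x∈ys (xs⊆ys (there z∈xs)) (All.lookup x∉xs z∈xs ∘ sym)))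
  where
  x∈ys : x ∈ ys
  x∈ys = xs⊆ys (here refl)
  ∈-─ : ∀ {x z : A} {ys} (x∈ys : x ∈ ys) → z ∈ ys → z ≢ x → z ∈ (ys Any.─ x∈ys)
  ∈-─ (here refl) (here refl)  z≢x = ⊥-elim (z≢x refl)
  ∈-─ (here refl) (there z∈ys) _   = z∈ys
  ∈-─ (there _)   (here refl)  _   = here refl
  ∈-─ (there p)   (there z∈ys) z≢x = there (∈-─ p z∈ys z≢x)

length≤card : ∀ {n} {P : V n → Bool} {ys : List (V n)} → Unique ys → (∀ {y} → y ∈ ys → P y ≡ true) → length ys ≤ card P
length≤card {n} {P} uys ys⊆P = subst (_ ≤_) (sym (countB≡length-filterᵇ P (allVecs n)))
  (Unique⇒length≤ uys λ {y} y∈ys → ∈-filter⁺ (T? ∘ P) (∈-allVecs y) (Equivalence.from T-≡ (ys⊆P y∈ys)))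

card≤length : ∀ {n} {P : V n → Bool} (ys : List (V n)) → (∀ v → P v ≡ true → v ∈ ys) → card P ≤ length ys
card≤length {n} {P} ys P⊆ys = subst (_≤ _) (sym (countB≡length-filterᵇ P (allVecs n)))
  (Unique⇒length≤ (Unique.filter⁺ (T? ∘ P) {xs = allVecs n} (allVecs-unique n))
    λ {v} v∈ → P⊆ys v (Equivalence.to T-≡ (proj₂ (∈-filter⁻ (T? ∘ P) {xs = allVecs n} v∈))))

card-injection : ∀ {m n} {P : V m → Bool} {Q : V n → Bool} (σ : V m → V n) →
                 (∀ {x y} → σ x ≡ σ y → x ≡ y) → (∀ x → P x ≡ true → Q (σ x) ≡ true) → card P ≤ card Q
card-injection {m} {P = P} {Q} σ σ-inj P⇒Qσ = begin
  card P                                ≡⟨ countB≡length-filterᵇ P (allVecs m) ⟩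
  length (filterᵇ P (allVecs m))         ≡⟨ length-map σ (filterᵇ P (allVecs m)) ⟨
  length (map σ (filterᵇ P (allVecs m))) ≤⟨ length≤card {P = Q} (Unique.map⁺ σ-inj (Unique.filter⁺ (T? ∘ P) {xs = allVecs m} (allVecs-unique m))) image⊆Q ⟩
  card Q                                ∎
  where
  open ≤-Reasoning
  image⊆Q : ∀ {y} → y ∈ map σ (filterᵇ P (allVecs m)) → Q y ≡ true
  image⊆Q y∈ with ∈-map⁻ σ y∈
  ... | x , x∈ , refl = P⇒Qσ x (Equivalence.to T-≡ (proj₂ (∈-filter⁻ (T? ∘ P) {xs = allVecs m} x∈)))

card-mono : ∀ {n} {P Q : V n → Bool} → (∀ v → P v ≡ true → Q v ≡ true) → card P ≤ card Q
card-mono = card-injection id id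

card-complement : ∀ {n} (P : V n → Bool) → card P + card (λ v → not (P v)) ≡ 2 ^ n
card-complement {n} P = trans (countB-complement P (allVecs n)) (length-allVecs n)

card-all : ∀ n → card {n} (λ _ → true) ≡ 2 ^ n
card-all n = trans (countB-all (allVecs n)) (length-allVecs n)
  where
  countB-all : ∀ {A : Set} (xs : List A) → countB (λ _ → true) xs ≡ length xs
  countB-all []       = refl
  countB-all (x ∷ xs) = cong suc (countB-all xs)

card-none : ∀ n → card {n} (λ _ → false) ≡ 0
card-none n = countB-none (allVecs n)
  where
  countB-none : ∀ {A : Set} (xs : List A) → countB (λ _ → false) xs ≡ 0
  countB-none []       = refl
  countB-none (_ ∷ xs) = countB-none xs

card-isZero : ∀ n → card {n} isZero ≡ 1
card-isZero n = ≤-antisym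
  (card≤length {n} {P = isZero} (zeroV ∷ []) λ v z → here (isZero⇒≡zeroV v z))
  (length≤card {n} {P = isZero} {ys = zeroV ∷ []} ([] ∷ []) λ { (here refl) → isZero-zeroV n })

card-split : ∀ {n} (P Q : V n → Bool) → card P ≡ card (λ v → P v ∧ Q v) + card (λ v → P v ∧ not (Q v))
card-split {n} P Q = countB-split P Q (allVecs n)

card-cong : ∀ {n} {P Q : V n → Bool} → (∀ v → P v ≡ Q v) → card P ≡ card Q
card-cong {n} P≗Q = countB-cong P≗Q (allVecs n)

sum-map-zero : ∀ {A : Set} (xs : List A) → sum (map (λ _ → 0) xs) ≡ 0
sum-map-zero []       = refl
sum-map-zero (_ ∷ xs) = sum-map-zero xs

sum-map-+ : ∀ {A : Set} (f g : A → ℕ) (xs : List A) →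
            sum (map (λ x → f x + g x) xs) ≡ sum (map f xs) + sum (map g xs)
sum-map-+ f g []       = refl
sum-map-+ f g (x ∷ xs) = trans (cong (f x + g x +_) (sum-map-+ f g xs)) (+-interchange (f x) (g x) _ _)

sum-map-*ˡ : ∀ {A : Set} (k : ℕ) (f : A → ℕ) (xs : List A) → sum (map (λ x → k * f x) xs) ≡ k * sum (map f xs)
sum-map-*ˡ k f []       = sym (*-zeroʳ k)
sum-map-*ˡ k f (x ∷ xs) = trans (cong (k * f x +_) (sum-map-*ˡ k f xs)) (sym (*-distribˡ-+ k (f x) _))

sum-map-mono : ∀ {A : Set} {f g : A → ℕ} → (∀ x → f x ≤ g x) → (xs : List A) → sum (map f xs) ≤ sum (map g xs)
sum-map-mono f≤g []       = z≤n
sum-map-mono f≤g (x ∷ xs) = +-mono-≤ (f≤g x) (sum-map-mono f≤g xs)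

sum-map-if : ∀ {A : Set} (P : A → Bool) (k : ℕ) (xs : List A) →
             sum (map (λ x → if P x then k else 0) xs) ≡ k * countB P xs
sum-map-if P k []       = sym (*-zeroʳ k)
sum-map-if P k (x ∷ xs) with P x
... | true  = trans (cong (k +_) (sum-map-if P k xs)) (sym (*-suc k _))
... | false = sum-map-if P k xs

countB-∷ : ∀ {A : Set} (P : A → Bool) x (xs : List A) → countB P (x ∷ xs) ≡ (if P x then 1 else 0) + countB P xs
countB-∷ P x xs with P x
... | true  = refl
... | false = refl

sum-countB-swap : ∀ {A B : Set} (P : A → B → Bool) (xs : List A) (ys : List B) →
                  sum (map (λ x → countB (P x) ys) xs) ≡ sum (map (λ y → countB (λ x → P x y) xs) ys)
sum-countB-swap P xs []       = sum-map-zero xs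
sum-countB-swap P xs (y ∷ ys) = begin
  sum (map (λ x → countB (P x) (y ∷ ys)) xs)
    ≡⟨ cong sum (map-cong (λ x → countB-∷ (P x) y ys) xs) ⟩
  sum (map (λ x → (if P x y then 1 else 0) + countB (P x) ys) xs)
    ≡⟨ sum-map-+ (λ x → if P x y then 1 else 0) (λ x → countB (P x) ys) xs ⟩
  sum (map (λ x → if P x y then 1 else 0) xs) + sum (map (λ x → countB (P x) ys) xs)
    ≡⟨ cong₂ _+_ (trans (sum-map-if (λ x → P x y) 1 xs) (*-identityˡ _)) (sum-countB-swap P xs ys) ⟩
  countB (λ x → P x y) xs + sum (map (λ y → countB (λ x → P x y) xs) ys)
    ∎
  where open ≡-Reasoning

length-concatMap : ∀ {A B : Set} (g : A → List B) {n} → (∀ x → length (g x) ≡ n) → ∀ xs →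
                   length (concatMap g xs) ≡ length xs * n
length-concatMap g g≡n []       = refl
length-concatMap g g≡n (x ∷ xs) =
  trans (length-++ (g x)) (cong₂ _+_ (g≡n x) (length-concatMap g g≡n xs))

-- Linear algebra

lincomb-linear : ∀ {r n} (bs : Vec (V r) n) → IsLinear (lincomb bs)
lincomb-linear []       []          []          = sym (⊕-identityʳ zeroV)
lincomb-linear (b ∷ bs) (true ∷ x)  (true ∷ y)  = begin
  lincomb bs (x ⊕ y)                         ≡⟨ lincomb-linear bs x y ⟩
  lincomb bs x ⊕ lincomb bs y                ≡⟨ ⊕-identityˡ _ ⟨
  zeroV ⊕ (lincomb bs x ⊕ lincomb bs y)      ≡⟨ cong (_⊕ _) (⊕-self b) ⟨
  (b ⊕ b) ⊕ (lincomb bs x ⊕ lincomb bs y)    ≡⟨ ⊕-interchange b b _ _ ⟩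
  (b ⊕ lincomb bs x) ⊕ (b ⊕ lincomb bs y)    ∎
  where open ≡-Reasoning
lincomb-linear (b ∷ bs) (true ∷ x)  (false ∷ y) = trans (cong (b ⊕_) (lincomb-linear bs x y)) (sym (⊕-assoc b _ _))
lincomb-linear (b ∷ bs) (false ∷ x) (true ∷ y)  = begin
  b ⊕ lincomb bs (x ⊕ y)                  ≡⟨ cong (b ⊕_) (lincomb-linear bs x y) ⟩
  b ⊕ (lincomb bs x ⊕ lincomb bs y)       ≡⟨ cong (b ⊕_) (⊕-comm _ _) ⟩
  b ⊕ (lincomb bs y ⊕ lincomb bs x)       ≡⟨ ⊕-assoc b _ _ ⟨
  (b ⊕ lincomb bs y) ⊕ lincomb bs x       ≡⟨ ⊕-comm _ _ ⟩
  lincomb bs x ⊕ (b ⊕ lincomb bs y)       ∎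
  where open ≡-Reasoning
lincomb-linear (b ∷ bs) (false ∷ x) (false ∷ y) = lincomb-linear bs x y

lincomb-zero : ∀ {r n} (bs : Vec (V r) n) → lincomb bs zeroV ≡ zeroV
lincomb-zero bs = linear-zero (lincomb-linear bs)

lincomb-++ : ∀ {r m n} (us : Vec (V r) m) (ws : Vec (V r) n) (a : V m) (b : V n) →
             lincomb (us ++ᵛ ws) (a ++ᵛ b) ≡ lincomb us a ⊕ lincomb ws b
lincomb-++ []       ws []          b = sym (⊕-identityˡ _)
lincomb-++ (u ∷ us) ws (true ∷ a)  b = trans (cong (u ⊕_) (lincomb-++ us ws a b)) (sym (⊕-assoc u _ _))
lincomb-++ (u ∷ us) ws (false ∷ a) b = lincomb-++ us ws a b

lincomb-map : ∀ {r s n} {f : V s → V r} → IsLinear f → (ks : Vec (V s) n) (a : V n) →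
              lincomb (mapᵛ f ks) a ≡ f (lincomb ks a)
lincomb-map f-lin []       []          = sym (linear-zero f-lin)
lincomb-map f-lin (k ∷ ks) (true ∷ a)  = trans (cong (_ ⊕_) (lincomb-map f-lin ks a)) (sym (f-lin k _))
lincomb-map f-lin (k ∷ ks) (false ∷ a) = lincomb-map f-lin ks a

LinIndep⇒injective : ∀ {r n} (bs : Vec (V r) n) → LinIndep bs → ∀ {x y} → lincomb bs x ≡ lincomb bs y → x ≡ y
LinIndep⇒injective bs indep {x} {y} eq =
  x⊕y≡0⇒x≡y (indep (x ⊕ y) (trans (lincomb-linear bs x y) (trans (cong (_⊕ _) eq) (⊕-self _))))

lincomb∈subspace : ∀ {r n} {H : V r → Bool} → IsSubspace H → {bs : Vec (V r) n} →
                   AllV (λ b → H b ≡ true) bs → ∀ c → H (lincomb bs c) ≡ true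
lincomb∈subspace (H0 , _)              []         []          = H0
lincomb∈subspace H-sub@(_ , H-closed) (Hb ∷ Hbs) (true ∷ c)  = H-closed _ _ Hb (lincomb∈subspace H-sub Hbs c)
lincomb∈subspace H-sub                (_ ∷ Hbs)  (false ∷ c) = lincomb∈subspace H-sub Hbs c

inSpan : ∀ {r n} → Vec (V r) n → V r → Bool
inSpan []       v = isZero v
inSpan (b ∷ bs) v = inSpan bs v ∨ inSpan bs (b ⊕ v)

inSpan-lincomb : ∀ {r n} (bs : Vec (V r) n) c → inSpan bs (lincomb bs c) ≡ true
inSpan-lincomb {r} []   []          = isZero-zeroV r
inSpan-lincomb (b ∷ bs) (false ∷ c) rewrite inSpan-lincomb bs c = refl
inSpan-lincomb (b ∷ bs) (true ∷ c)
  rewrite ⊕-cancelˡ b (lincomb bs c) | inSpan-lincomb bs c = ∨-zeroʳ _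

inSpan⇒lincomb : ∀ {r n} (bs : Vec (V r) n) v → inSpan bs v ≡ true → ∃ λ c → lincomb bs c ≡ v
inSpan⇒lincomb []       v h = [] , sym (isZero⇒≡zeroV v h)
inSpan⇒lincomb (b ∷ bs) v h with inSpan bs v in e
... | true  = let c , eq = inSpan⇒lincomb bs v e in false ∷ c , eq
... | false = let c , eq = inSpan⇒lincomb bs (b ⊕ v) h in true ∷ c , trans (cong (b ⊕_) eq) (⊕-cancelˡ b v)

lincomb⇒inSpan : ∀ {r n} (bs : Vec (V r) n) {c v} → lincomb bs c ≡ v → inSpan bs v ≡ true
lincomb⇒inSpan bs {c} refl = inSpan-lincomb bs c

inSpan-subspace : ∀ {r n} (bs : Vec (V r) n) → IsSubspace (inSpan bs)
inSpan-subspace bs = lincomb⇒inSpan bs (lincomb-zero bs) , closed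
  where
  closed : ∀ x y → inSpan bs x ≡ true → inSpan bs y ≡ true → inSpan bs (x ⊕ y) ≡ true
  closed x y x∈ y∈ with inSpan⇒lincomb bs x x∈ | inSpan⇒lincomb bs y y∈
  ... | a , refl | c , refl = lincomb⇒inSpan bs (lincomb-linear bs a c)

inSpan-hasDim : ∀ {r n} (bs : Vec (V r) n) → LinIndep bs → HasDim (inSpan bs) n
inSpan-hasDim bs indep = bs , indep , inSpan⇒lincomb bs , inSpan-lincomb bs

card-inSpan : ∀ {r n} (bs : Vec (V r) n) → LinIndep bs → card (inSpan bs) ≡ 2 ^ n
card-inSpan {r} {n} bs indep = ≤-antisym
  (subst (card (inSpan bs) ≤_) (trans (length-map (lincomb bs) (allVecs n)) (length-allVecs n))
    (card≤length _ λ v v∈ → let c , eq = inSpan⇒lincomb bs v v∈ in subst (_∈ _) eq (∈-map⁺ (lincomb bs) (∈-allVecs c))))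
  (subst (_≤ card (inSpan bs)) (card-all n)
    (card-injection (lincomb bs) (LinIndep⇒injective bs indep) (λ c _ → inSpan-lincomb bs c)))

2^-cancel-≤ : ∀ {m n} → 2 ^ m ≤ 2 ^ n → m ≤ n
2^-cancel-≤ le = ≮⇒≥ λ n<m → <⇒≱ (^-monoʳ-< 2 (s≤s (s≤s z≤n)) n<m) le

2^-injective : ∀ {m n} → 2 ^ m ≡ 2 ^ n → m ≡ n
2^-injective eq = ≤-antisym (2^-cancel-≤ (≤-reflexive eq)) (2^-cancel-≤ (≤-reflexive (sym eq)))

card≤2^ : ∀ {n} (P : V n → Bool) → card P ≤ 2 ^ n
card≤2^ P = subst (card P ≤_) (card-complement P) (m≤m+n _ _)

LinIndep⇒≤ : ∀ {r n} (bs : Vec (V r) n) → LinIndep bs → n ≤ r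
LinIndep⇒≤ bs indep = 2^-cancel-≤ (subst (_≤ _) (card-inSpan bs indep) (card≤2^ (inSpan bs)))

LinIndep-∷ : ∀ {r n} (ws : Vec (V r) n) {v} → LinIndep ws → inSpan ws v ≡ false → LinIndep (v ∷ ws)
LinIndep-∷ ws indep v∉ (true ∷ c) eq with () ← trans (sym (lincomb⇒inSpan ws (sym (x⊕y≡0⇒x≡y eq)))) v∉
LinIndep-∷ ws indep v∉ (false ∷ c) eq = cong (false ∷_) (indep c eq)

record Extension {r n} (T : V r → Bool) (ws : Vec (V r) n) : Set where
  field
    {dim}       : ℕ
    vectors     : Vec (V r) dim
    independent : LinIndep (vectors ++ᵛ ws)
    inside      : AllV (λ u → T u ≡ true) vectors
    spanning    : ∀ v → T v ≡ true → inSpan (vectors ++ᵛ ws) v ≡ true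

-- Greedy extension; the fuel can never run out because independent lists in F₂^r have length ≤ r.
extend : ∀ {r n} (T : V r → Bool) {ws : Vec (V r) n} → LinIndep ws → Extension T ws
extend {r} {n} T {ws} indep = go r [] (m≤m+n r n) indep []
  where
  go : ∀ fuel {m} (us : Vec (V r) m) → r ≤ fuel + (m + n) → LinIndep (us ++ᵛ ws) →
       AllV (λ u → T u ≡ true) us → Extension T ws
  go fuel {m} us bound indep inside with search (λ v → T v ∧ not (inSpan (us ++ᵛ ws) v))
  ... | inj₂ none = record
    { vectors = us ; independent = indep ; inside = inside
    ; spanning = λ v Tv → not-injective (subst (λ b → b ∧ _ ≡ false) Tv (none v)) }
  ... | inj₁ (v , h) with ∧-≡true (T v) _ h
  ...   | Tv , v∉ with fuel
  ...     | zero     = ⊥-elim (<⇒≱ (LinIndep⇒≤ (v ∷ us ++ᵛ ws) (LinIndep-∷ (us ++ᵛ ws) indep (not-≡true v∉))) bound)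
  ...     | suc fuel = go fuel (v ∷ us) (subst (r ≤_) (sym (+-suc fuel (m + n))) bound)
                         (LinIndep-∷ (us ++ᵛ ws) indep (not-≡true v∉)) (Tv ∷ inside)

record QuotientMap {r} (H : V r → Bool) (j : ℕ) : Set where
  field
    π          : V r → V j
    linear     : IsLinear π
    surjective : ∀ γ → ∃ λ v → π v ≡ γ
    kernel     : ∀ v → H v ≡ isZero (π v)

module _ {r d j} {H : V r → Bool} (bs : Vec (V r) d)
         (H⇒span : ∀ v → H v ≡ true → ∃ λ c → lincomb bs c ≡ v) (span⇒H : ∀ c → H (lincomb bs c) ≡ true)
         (us : Vec (V r) j) (indep : LinIndep (us ++ᵛ bs)) (spanning : ∀ v → inSpan (us ++ᵛ bs) v ≡ true)
         where

  private
    B : Vec (V r) (j + d)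
    B = us ++ᵛ bs

    coords : V r → V (j + d)
    coords v = proj₁ (inSpan⇒lincomb B v (spanning v))

    lincomb-coords : ∀ v → lincomb B (coords v) ≡ v
    lincomb-coords v = proj₂ (inSpan⇒lincomb B v (spanning v))

    coords-unique : ∀ {c v} → lincomb B c ≡ v → coords v ≡ c
    coords-unique eq = LinIndep⇒injective B indep (trans (lincomb-coords _) (sym eq))

    coords-linear : IsLinear coords
    coords-linear x y = coords-unique (begin
      lincomb B (coords x ⊕ coords y)                ≡⟨ lincomb-linear B (coords x) (coords y) ⟩
      lincomb B (coords x) ⊕ lincomb B (coords y)    ≡⟨ cong₂ _⊕_ (lincomb-coords x) (lincomb-coords y) ⟩
      x ⊕ y                                          ∎)
      where open ≡-Reasoning

    lincomb-zeroV-++ : ∀ c → lincomb B (zeroV ++ᵛ c) ≡ lincomb bs c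
    lincomb-zeroV-++ c = trans (lincomb-++ us bs zeroV c) (trans (cong (_⊕ _) (lincomb-zero us)) (⊕-identityˡ _))

    π : V r → V j
    π v = take j (coords v)

    kernel⇒H : ∀ v → isZero (π v) ≡ true → H v ≡ true
    kernel⇒H v πv≡0 = subst (λ w → H w ≡ true) (begin
      lincomb bs (drop j (coords v))                  ≡⟨ lincomb-zeroV-++ (drop j (coords v)) ⟨
      lincomb B (zeroV ++ᵛ drop j (coords v))         ≡⟨ cong (λ γ → lincomb B (γ ++ᵛ drop j (coords v))) (isZero⇒≡zeroV (π v) πv≡0) ⟨
      lincomb B (π v ++ᵛ drop j (coords v))           ≡⟨ cong (lincomb B) (take++drop≡id j (coords v)) ⟩
      lincomb B (coords v)                            ≡⟨ lincomb-coords v ⟩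
      v                                               ∎) (span⇒H _)
      where open ≡-Reasoning

    H⇒kernel : ∀ v → H v ≡ true → isZero (π v) ≡ true
    H⇒kernel v Hv with H⇒span v Hv
    ... | c , refl = subst (λ γ → isZero γ ≡ true)
                       (sym (trans (cong (take j) (coords-unique (lincomb-zeroV-++ c))) (take-++ zeroV c)))
                       (isZero-zeroV j)

  complement⇒QuotientMap : QuotientMap H j
  complement⇒QuotientMap = record
    { π          = π
    ; linear     = λ x y → trans (cong (take j) (coords-linear x y)) (take-zipWith _xor_ (coords x) (coords y))
    ; surjective = λ γ → lincomb B (γ ++ᵛ zeroV) , trans (cong (take j) (coords-unique {c = γ ++ᵛ zeroV} refl)) (take-++ γ zeroV)
    ; kernel     = λ v → Bool-≡ (H⇒kernel v) (kernel⇒H v)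
    }

HasCodim⇒QuotientMap : ∀ {r j} {H : V r → Bool} → HasCodim H j → QuotientMap H j
HasCodim⇒QuotientMap {r} {j} (d , d+j≡r , bs , bs-indep , H⇒span , span⇒H) =
  fromExtension (Extension.vectors ext) (Extension.independent ext) (λ v → Extension.spanning ext v refl) dim≡j
  where
  ext : Extension (λ _ → true) bs
  ext = extend (λ _ → true) bs-indep
  fromExtension : ∀ {m} (us : Vec (V r) m) → LinIndep (us ++ᵛ bs) → (∀ v → inSpan (us ++ᵛ bs) v ≡ true) → m ≡ j → QuotientMap _ j
  fromExtension us indep spanning refl = complement⇒QuotientMap bs H⇒span span⇒H us indep spanning
  dim≡j : Extension.dim ext ≡ j
  dim≡j = +-cancelʳ-≡ d _ _ (trans (2^-injective (begin
    2 ^ (Extension.dim ext + d)                            ≡⟨ card-inSpan (Extension.vectors ext ++ᵛ bs) (Extension.independent ext) ⟨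
    card (inSpan (Extension.vectors ext ++ᵛ bs))           ≡⟨ card-cong (λ v → Extension.spanning ext v refl) ⟩
    card {r} (λ _ → true)                                  ≡⟨ card-all r ⟩
    2 ^ r                                                  ∎)) (trans (sym d+j≡r) (+-comm d j)))
    where open ≡-Reasoning

-- Hyperplanes through a subspace

IsFunctional : ∀ {n} → (V n → Bool) → Set
IsFunctional f = ∀ x y → f (x ⊕ y) ≡ f x xor f y

functional-zero : ∀ {n} (f : V n → Bool) → IsFunctional f → f zeroV ≡ false
functional-zero f f-lin = begin
  f zeroV                  ≡⟨ cong f (⊕-identityˡ zeroV) ⟨
  f (zeroV ⊕ zeroV)        ≡⟨ f-lin zeroV zeroV ⟩
  f zeroV xor f zeroV      ≡⟨ xor-same (f zeroV) ⟩
  false                    ∎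
  where open ≡-Reasoning

kernel-subspace : ∀ {n} (f : V n → Bool) → IsFunctional f → IsSubspace (λ v → not (f v))
kernel-subspace f f-lin = cong not (functional-zero f f-lin) , closed
  where
  closed : ∀ x y → not (f x) ≡ true → not (f y) ≡ true → not (f (x ⊕ y)) ≡ true
  closed x y fx fy rewrite f-lin x y | not-≡true fx | not-≡true fy = refl

-- Translation by a vector outside the kernel swaps the kernel and its complement.
card-functional : ∀ {n} (f : V n → Bool) → IsFunctional f → ∀ {a} → f a ≡ true →
                  card f ≡ card (λ v → not (f v))
card-functional f f-lin {a} fa = ≤-antisym
  (card-injection (_⊕ a) ⊕a-injective λ x fx → cong not (trans (f-lin x a) (cong₂ _xor_ fx fa)))
  (card-injection (_⊕ a) ⊕a-injective λ x nfx → trans (f-lin x a) (cong₂ _xor_ (not-≡true nfx) fa))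
  where
  ⊕a-injective : ∀ {x y} → x ⊕ a ≡ y ⊕ a → x ≡ y
  ⊕a-injective {x} {y} eq = trans (sym (⊕-cancelʳ x a)) (trans (cong (_⊕ a) eq) (⊕-cancelʳ y a))

card-functional-half : ∀ {n} (f : V n → Bool) → IsFunctional f → ∀ {a} → f a ≡ true →
                       2 * card f ≡ 2 ^ n × 2 * card (λ v → not (f v)) ≡ 2 ^ n
card-functional-half f f-lin fa =
    trans (cong (card f +_) (trans (+-identityʳ _) card-f≡)) (card-complement f)
  , trans (cong₂ _+_ (sym card-f≡) (+-identityʳ _)) (card-complement f)
  where
  card-f≡ : card f ≡ card (λ v → not (f v))
  card-f≡ = card-functional f f-lin fa

infix 7 _·_
_·_ : ∀ {n} → V n → V n → Bool
[]      · []      = false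
(a ∷ α) · (b ∷ x) = (a ∧ b) xor (α · x)

·-linearʳ : ∀ {n} (α : V n) → IsFunctional (α ·_)
·-linearʳ []      []      []      = refl
·-linearʳ (a ∷ α) (b ∷ x) (c ∷ y) = begin
  (a ∧ (b xor c)) xor (α · (x ⊕ y))                      ≡⟨ cong₂ _xor_ (∧-distribˡ-xor a b c) (·-linearʳ α x y) ⟩
  ((a ∧ b) xor (a ∧ c)) xor ((α · x) xor (α · y))        ≡⟨ xor-interchange (a ∧ b) (a ∧ c) (α · x) (α · y) ⟩
  ((a ∧ b) xor (α · x)) xor ((a ∧ c) xor (α · y))        ∎
  where open ≡-Reasoning

·-linearˡ : ∀ {n} (x : V n) → IsFunctional (_· x)
·-linearˡ []      []      []      = refl
·-linearˡ (c ∷ x) (a ∷ α) (b ∷ β) = begin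
  ((a xor b) ∧ c) xor ((α ⊕ β) · x)                      ≡⟨ cong₂ _xor_ (∧-distribʳ-xor c a b) (·-linearˡ x α β) ⟩
  ((a ∧ c) xor (b ∧ c)) xor ((α · x) xor (β · x))        ≡⟨ xor-interchange (a ∧ c) (b ∧ c) (α · x) (β · x) ⟩
  ((a ∧ c) xor (α · x)) xor ((b ∧ c) xor (β · x))        ∎
  where open ≡-Reasoning

·-nonzero : ∀ {n} (x : V n) → isZero x ≡ false → ∃ λ α → α · x ≡ true
·-nonzero (true  ∷ x) _  = (true ∷ zeroV) , cong (true xor_) (·-zeroˡ x)
  where
  ·-zeroˡ : ∀ {n} (x : V n) → zeroV · x ≡ false
  ·-zeroˡ []      = refl
  ·-zeroˡ (_ ∷ x) = ·-zeroˡ x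
·-nonzero (false ∷ x) nz = let α , αx = ·-nonzero x nz in (false ∷ α) , αx

·-comm : ∀ {n} (α x : V n) → α · x ≡ x · α
·-comm []      []      = refl
·-comm (a ∷ α) (b ∷ x) = cong₂ _xor_ (∧-comm a b) (·-comm α x)

·-zeroʳ : ∀ {n} (α : V n) → α · zeroV ≡ false
·-zeroʳ []      = refl
·-zeroʳ (a ∷ α) = trans (cong (_xor (α · zeroV)) (∧-zeroʳ a)) (·-zeroʳ α)

module HyperplanesThrough {r i} {H : V r → Bool} (q : QuotientMap H (suc i)) where

  open QuotientMap q

  hyperplane-functional : ∀ α → IsFunctional (λ v → α · π v)
  hyperplane-functional α x y = trans (cong (α ·_) (linear x y)) (·-linearʳ α (π x) (π y))

  hyperplane-proper : ∀ α → isZero α ≡ false → ∃ λ v → α · π v ≡ true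
  hyperplane-proper α α≢0 with ·-nonzero α α≢0
  ... | γ , γα with surjective γ
  ...   | v , refl = v , trans (·-comm α (π v)) γα

  card-dual : ∀ (x : V (suc i)) → card (λ α → α · x) ≡ (if isZero x then 0 else 2 ^ i)
  card-dual x with isZero x in x≡0
  ... | true  = trans (card-cong {P = λ α → α · x} λ α → trans (cong (α ·_) (isZero⇒≡zeroV x x≡0)) (·-zeroʳ α)) (card-none (suc i))
  ... | false = let α , αx = ·-nonzero x x≡0 in
                *-cancelˡ-≡ _ _ 2 (proj₁ (card-functional-half (_· x) (·-linearˡ x) {α} αx))

  -- Each point outside H lies off exactly 2^i of the hyperplanes through H.
  sum-hyperplanes : (Y : V r → Bool) →
    sum (map (λ α → card (λ v → Y v ∧ α · π v)) (allVecs (suc i))) ≡ 2 ^ i * card (λ v → Y v ∧ not (H v))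
  sum-hyperplanes Y = begin
    sum (map (λ α → card (λ v → Y v ∧ α · π v)) (allVecs (suc i)))
      ≡⟨ sum-countB-swap (λ α v → Y v ∧ α · π v) (allVecs (suc i)) (allVecs r) ⟩
    sum (map (λ v → card (λ α → Y v ∧ α · π v)) (allVecs r))
      ≡⟨ cong sum (map-cong per-point (allVecs r)) ⟩
    sum (map (λ v → if Y v ∧ not (H v) then 2 ^ i else 0) (allVecs r))
      ≡⟨ sum-map-if (λ v → Y v ∧ not (H v)) (2 ^ i) (allVecs r) ⟩
    2 ^ i * card (λ v → Y v ∧ not (H v))
      ∎
    where
    open ≡-Reasoning
    per-point : ∀ v → card (λ α → Y v ∧ α · π v) ≡ (if Y v ∧ not (H v) then 2 ^ i else 0)
    per-point v rewrite kernel v with Y v | isZero (π v) | card-dual (π v)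
    ... | false | _     | _  = card-none (suc i)
    ... | true  | true  | eq = eq
    ... | true  | false | eq = eq

averaging-arithmetic : ∀ N T R a b n₀ .{{_ : NonZero N}} → 1 + n₀ ≡ 2 * N →
                       T * (a + b) < 3 * R → R * n₀ ≤ T * (N * b) → N * T * a < (N + 1) * R
averaging-arithmetic N T R a b n₀ n₀≡ dense lower = +-cancelʳ-< (R * n₀) (N * T * a) ((N + 1) * R) (begin-strict
  N * T * a + R * n₀          ≤⟨ +-monoʳ-≤ (N * T * a) lower ⟩
  N * T * a + T * (N * b)     ≡⟨ factor N T a b ⟩
  N * (T * (a + b))           <⟨ *-monoʳ-< N dense ⟩
  N * (3 * R)                 ≡⟨ triple N R ⟩
  (N + 2 * N) * R             ≡⟨ cong (λ k → (N + k) * R) n₀≡ ⟨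
  (N + (1 + n₀)) * R          ≡⟨ regroup N n₀ R ⟩
  (N + 1) * R + R * n₀        ∎)
  where
  open ≤-Reasoning
  factor : ∀ N T a b → N * T * a + T * (N * b) ≡ N * (T * (a + b))
  factor = solve-∀
  triple : ∀ N R → N * (3 * R) ≡ (N + 2 * N) * R
  triple = solve-∀
  regroup : ∀ N n₀ R → (N + (1 + n₀)) * R ≡ (N + 1) * R + R * n₀
  regroup = solve-∀

-- `Y v ∧ f v` selects the points of Y off the hyperplane ker f.
codim-bound : ∀ {r} (Y : V r → Bool) (T R : ℕ) → T * card Y < 3 * R →
  (∀ f → IsFunctional f → ∀ {a} → f a ≡ true → R ≤ T * card (λ v → Y v ∧ f v)) →
  ∀ {H : V r → Bool} i → HasCodim H (suc i) → 2 ^ i * T * card (λ v → Y v ∧ H v) < (2 ^ i + 1) * R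
codim-bound {r} Y T R dense misses {H} i codim =
  averaging-arithmetic (2 ^ i) T R _ _ _ {{m^n≢0 2 i}} n₀≡ (subst (λ k → T * k < 3 * R) (card-split Y H) dense) lower
  where
  q : QuotientMap H (suc i)
  q = HasCodim⇒QuotientMap codim
  open QuotientMap q
  open HyperplanesThrough q

  n₀≡ : 1 + card {suc i} (λ α → not (isZero α)) ≡ 2 * 2 ^ i
  n₀≡ = trans (cong (_+ card {suc i} (λ α → not (isZero α))) (sym (card-isZero (suc i)))) (card-complement {suc i} isZero)

  each : ∀ (α : V (suc i)) → (if not (isZero α) then R else 0) ≤ T * card (λ v → Y v ∧ α · π v)
  each α with isZero α in α≡0
  ... | true  = z≤n
  ... | false = let v , αv = hyperplane-proper α α≡0 in misses _ (hyperplane-functional α) αv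

  lower : R * card {suc i} (λ α → not (isZero α)) ≤ T * (2 ^ i * card (λ v → Y v ∧ not (H v)))
  lower = begin
    R * card {suc i} (λ α → not (isZero α))                                 ≡⟨ sum-map-if (λ α → not (isZero α)) R (allVecs (suc i)) ⟨
    sum (map (λ α → if not (isZero α) then R else 0) (allVecs (suc i)))        ≤⟨ sum-map-mono each (allVecs (suc i)) ⟩
    sum (map (λ α → T * card (λ v → Y v ∧ α · π v)) (allVecs (suc i)))          ≡⟨ sum-map-*ˡ T _ (allVecs (suc i)) ⟩
    T * sum (map (λ α → card (λ v → Y v ∧ α · π v)) (allVecs (suc i)))          ≡⟨ cong (T *_) (sum-hyperplanes Y) ⟩
    T * (2 ^ i * card (λ v → Y v ∧ not (H v)))                                 ∎
    where open ≤-Reasoning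

-- Restrictions, embeddings and avoiding subspaces

LinIndep-[] : ∀ {r} → LinIndep {r} []
LinIndep-[] [] _ = refl

units : ∀ {k} → V k → List (V k)
units []          = []
units (true ∷ c)  = (true ∷ zeroV) ∷ map (false ∷_) (units c)
units (false ∷ c) = map (false ∷_) (units c)

sumV-map-false : ∀ {k} (xs : List (V k)) → sumV (map (false ∷_) xs) ≡ false ∷ sumV xs
sumV-map-false []       = refl
sumV-map-false (x ∷ xs) = cong ((false ∷ x) ⊕_) (sumV-map-false xs)

sumV-units : ∀ {k} (c : V k) → sumV (units c) ≡ c
sumV-units []          = refl
sumV-units (true ∷ c)  = trans (cong ((true ∷ zeroV) ⊕_) (sumV-map-false (units c)))
                           (cong (true ∷_) (trans (⊕-identityˡ _) (sumV-units c)))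
sumV-units (false ∷ c) = trans (sumV-map-false (units c)) (cong (false ∷_) (sumV-units c))

units-lincomb : ∀ {r k} (P : V r → Bool) {ws : Vec (V r) k} → AllV (λ w → P w ≡ true) ws →
                ∀ c → All (λ u → P (lincomb ws u) ≡ true) (units c)
units-lincomb P []          []          = []
units-lincomb P {w ∷ ws} (Pw ∷ Pws) (true ∷ c) =
  subst (λ x → P x ≡ true) (sym (trans (cong (w ⊕_) (lincomb-zero ws)) (⊕-identityʳ w))) Pw
  ∷ All.map⁺ (units-lincomb P Pws c)
units-lincomb P (_ ∷ Pws)   (false ∷ c) = All.map⁺ (units-lincomb P Pws c)

restrict : (M : Matroid) {k : ℕ} (ws : Vec (V (rank M)) k) → AllV (λ w → E M w ≡ true) ws → Matroid
restrict M {k} ws ws⊆E = record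
  { rank    = k
  ; E       = λ c → E M (lincomb ws c)
  ; nonzero = subst (λ w → E M w ≡ false) (sym (lincomb-zero ws)) (nonzero M)
  ; spans   = λ c → units c , units-lincomb (E M) ws⊆E c , sumV-units c
  }

restrict-contained : (M : Matroid) {k : ℕ} (ws : Vec (V (rank M)) k) (ws⊆E : AllV (λ w → E M w ≡ true) ws) →
                     LinIndep ws → Contains M (restrict M ws ws⊆E)
restrict-contained M ws _ indep = lincomb ws , lincomb-linear ws , (λ x y → LinIndep⇒injective ws indep) , (λ _ Ex → Ex)

Contains-trans : ∀ {L M N} → Contains L M → Contains M N → Contains L N
Contains-trans (ι , ι-lin , ι-inj , ι-E) (κ , κ-lin , κ-inj , κ-E) =
  (ι ∘ κ) , (λ x y → trans (cong ι (κ-lin x y)) (ι-lin (κ x) (κ y))) ,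
  (λ x y eq → κ-inj x y (ι-inj (κ x) (κ y) eq)) , (λ x Ex → ι-E (κ x) (κ-E x Ex))

Contains-PG-suc : ∀ M {s} → (F : Contains M (PG s)) → ∀ a → (∀ u → proj₁ F u ≢ a) →
                  (∀ u → E M (a ⊕ proj₁ F u) ≡ true) → Contains M (PG (suc s))
Contains-PG-suc M (F , F-lin , F-inj , F-E) a a∉F a⊕F⊆E = ι , ι-lin , ι-inj , ι-E
  where
  ι : V (suc _) → V (rank M)
  ι (false ∷ u) = F u
  ι (true ∷ u)  = a ⊕ F u
  ι-lin : ∀ x y → ι (x ⊕ y) ≡ ι x ⊕ ι y
  ι-lin (false ∷ x) (false ∷ y) = F-lin x y
  ι-lin (true ∷ x)  (false ∷ y) = trans (cong (a ⊕_) (F-lin x y)) (sym (⊕-assoc a _ _))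
  ι-lin (false ∷ x) (true ∷ y)  = begin
    a ⊕ F (x ⊕ y)        ≡⟨ cong (a ⊕_) (F-lin x y) ⟩
    a ⊕ (F x ⊕ F y)      ≡⟨ ⊕-assoc a (F x) (F y) ⟨
    (a ⊕ F x) ⊕ F y      ≡⟨ cong (_⊕ F y) (⊕-comm a (F x)) ⟩
    (F x ⊕ a) ⊕ F y      ≡⟨ ⊕-assoc (F x) a (F y) ⟩
    F x ⊕ (a ⊕ F y)      ∎
    where open ≡-Reasoning
  ι-lin (true ∷ x)  (true ∷ y)  = begin
    F (x ⊕ y)                ≡⟨ F-lin x y ⟩
    F x ⊕ F y                ≡⟨ ⊕-identityˡ _ ⟨
    zeroV ⊕ (F x ⊕ F y)      ≡⟨ cong (_⊕ _) (⊕-self a) ⟨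
    (a ⊕ a) ⊕ (F x ⊕ F y)    ≡⟨ ⊕-interchange a a (F x) (F y) ⟩
    (a ⊕ F x) ⊕ (a ⊕ F y)    ∎
    where open ≡-Reasoning
  ι-inj : ∀ x y → ι x ≡ ι y → x ≡ y
  ι-inj (false ∷ x) (false ∷ y) eq = cong (false ∷_) (F-inj x y eq)
  ι-inj (true ∷ x)  (true ∷ y)  eq = cong (true ∷_) (F-inj x y (⊕-injectiveˡ a eq))
  ι-inj (false ∷ x) (true ∷ y)  eq =
    ⊥-elim (a∉F (x ⊕ y) (trans (F-lin x y) (trans (cong (_⊕ F y) eq) (⊕-cancelʳ a (F y)))))
  ι-inj (true ∷ x)  (false ∷ y) eq =
    ⊥-elim (a∉F (x ⊕ y) (trans (F-lin x y) (trans (cong (F x ⊕_) (sym eq)) (trans (⊕-comm (F x) _) (⊕-cancelʳ a (F x))))))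
  ι-E : ∀ x → E (PG (suc _)) x ≡ true → E M (ι x) ≡ true
  ι-E (false ∷ u) Eu = F-E u Eu
  ι-E (true ∷ u)  _  = a⊕F⊆E u

avoids-zero : (M : Matroid) → AvoidsAtCodim M (rank M)
avoids-zero M = inSpan [] , inSpan-subspace [] , (0 , refl , inSpan-hasDim [] LinIndep-[]) ,
                λ v v≡0 → subst (λ w → E M w ≡ false) (sym (isZero⇒≡zeroV v v≡0)) (nonzero M)

¬¬-least : (P : ℕ → Set) → ∀ n → P n → ¬ ¬ (∃ λ c → P c × (∀ k → k < c → ¬ P k))
¬¬-least P = <-rec _ λ n rec Pn no-least → no-least (n , Pn , λ k k<n Pk → rec k<n Pk no-least)

¬¬-critical : (M : Matroid) → ¬ ¬ (∃ λ c → IsCriticalNumber M c)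
¬¬-critical M = ¬¬-least (AvoidsAtCodim M) (rank M) (avoids-zero M)

module _ (M : Matroid) {k m} (ws : Vec (V (rank M)) k) (us : Vec (V (rank M)) m)
         (indep : LinIndep (us ++ᵛ ws))
         (E-closed : ∀ v → E M v ≡ true → inSpan (us ++ᵛ ws) v ≡ true → inSpan ws v ≡ true) where

  private
    Lw : V k → V (rank M)
    Lw = lincomb ws

    Lu : V m → V (rank M)
    Lu = lincomb us

    lincomb-swap : ∀ {e} (ks : Vec (V k) e) a b →
                   lincomb (mapᵛ Lw ks ++ᵛ us) (a ++ᵛ b) ≡ lincomb (us ++ᵛ ws) (b ++ᵛ lincomb ks a)
    lincomb-swap ks a b = begin
      lincomb (mapᵛ Lw ks ++ᵛ us) (a ++ᵛ b)      ≡⟨ lincomb-++ (mapᵛ Lw ks) us a b ⟩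
      lincomb (mapᵛ Lw ks) a ⊕ Lu b              ≡⟨ cong (_⊕ Lu b) (lincomb-map (lincomb-linear ws) ks a) ⟩
      Lw (lincomb ks a) ⊕ Lu b                   ≡⟨ ⊕-comm _ _ ⟩
      Lu b ⊕ Lw (lincomb ks a)                   ≡⟨ lincomb-++ us ws b _ ⟨
      lincomb (us ++ᵛ ws) (b ++ᵛ lincomb ks a)   ∎
      where open ≡-Reasoning

  lift-avoiding : ∀ {e} {K : V k → Bool} → HasDim K e → (∀ κ → K κ ≡ true → E M (Lw κ) ≡ false) →
                  Σ (V (rank M) → Bool) λ K′ → IsSubspace K′ × HasDim K′ (e + m) × (∀ v → K′ v ≡ true → E M v ≡ false)
  lift-avoiding {e} {K} (ks , ks-indep , _ , ks⊆K) K-avoids =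
    inSpan B , inSpan-subspace B , inSpan-hasDim B B-indep , B-avoids
    where
    B : Vec (V (rank M)) (e + m)
    B = mapᵛ Lw ks ++ᵛ us

    B-indep : LinIndep B
    B-indep cc B≡0 with splitAt e cc
    ... | a , b , refl with ++≡zeroV b (lincomb ks a) (indep _ (trans (sym (lincomb-swap ks a b)) B≡0))
    ...   | b≡0 , κ≡0 = trans (cong₂ _++ᵛ_ (ks-indep a κ≡0) b≡0) (zeroV-++ e m)

    in-ws : ∀ a b → b ≡ zeroV → lincomb B (a ++ᵛ b) ≡ Lw (lincomb ks a)
    in-ws a b refl = begin
      lincomb B (a ++ᵛ zeroV)                         ≡⟨ lincomb-swap ks a zeroV ⟩
      lincomb (us ++ᵛ ws) (zeroV ++ᵛ lincomb ks a)    ≡⟨ lincomb-++ us ws zeroV _ ⟩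
      Lu zeroV ⊕ Lw (lincomb ks a)                    ≡⟨ cong (_⊕ _) (lincomb-zero us) ⟩
      zeroV ⊕ Lw (lincomb ks a)                       ≡⟨ ⊕-identityˡ _ ⟩
      Lw (lincomb ks a)                               ∎
      where open ≡-Reasoning

    E⇒b≡0 : ∀ a b → E M (lincomb B (a ++ᵛ b)) ≡ true → b ≡ zeroV
    E⇒b≡0 a b Ev with inSpan⇒lincomb ws _ (E-closed _ Ev (lincomb⇒inSpan (us ++ᵛ ws) (sym (lincomb-swap ks a b))))
    ... | c′ , c′≡ = proj₁ (++≡zeroV b (κ ⊕ c′) (indep _ (begin
      lincomb (us ++ᵛ ws) (b ++ᵛ (κ ⊕ c′))      ≡⟨ lincomb-++ us ws b (κ ⊕ c′) ⟩
      Lu b ⊕ Lw (κ ⊕ c′)                        ≡⟨ cong (Lu b ⊕_) (lincomb-linear ws κ c′) ⟩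
      Lu b ⊕ (Lw κ ⊕ Lw c′)                     ≡⟨ ⊕-assoc (Lu b) (Lw κ) (Lw c′) ⟨
      (Lu b ⊕ Lw κ) ⊕ Lw c′                     ≡⟨ cong₂ _⊕_ (trans (lincomb-swap ks a b) (lincomb-++ us ws b κ)) (sym c′≡) ⟨
      v ⊕ v                                     ≡⟨ ⊕-self v ⟩
      zeroV                                     ∎)))
      where
      open ≡-Reasoning
      κ : V k
      κ = lincomb ks a
      v : V (rank M)
      v = lincomb B (a ++ᵛ b)

    B-avoids : ∀ v → inSpan B v ≡ true → E M v ≡ false
    B-avoids v v∈B with inSpan⇒lincomb B v v∈B
    ... | cc , refl with splitAt e cc
    ...   | a , b , refl with isZero b in b≡0 | E M (lincomb B (a ++ᵛ b)) in Ev
    ...     | _     | false = refl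
    ...     | true  | true  = trans (sym Ev) (trans (cong (E M) (in-ws a b (isZero⇒≡zeroV b b≡0))) (K-avoids _ (ks⊆K a)))
    ...     | false | true  = trans (sym (isZero-zeroV m)) (trans (cong isZero (sym (E⇒b≡0 a b Ev))) b≡0)

-- Density arithmetic

sparse⇒dense : ∀ S K m y → 3 ≤ S → m + y ≡ K → S * y < 3 * K → (S ∸ 3) * K < S * m
sparse⇒dense S K m y 3≤S m+y≡K sparse = +-cancelʳ-< (3 * K) ((S ∸ 3) * K) (S * m) (begin-strict
  (S ∸ 3) * K + 3 * K   ≡⟨ *-distribʳ-+ K (S ∸ 3) 3 ⟨
  (S ∸ 3 + 3) * K       ≡⟨ cong (_* K) (m∸n+n≡m 3≤S) ⟩
  S * K                 ≡⟨ cong (S *_) m+y≡K ⟨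
  S * (m + y)           ≡⟨ *-distribˡ-+ S m y ⟩
  S * m + S * y         <⟨ +-monoʳ-< (S * m) sparse ⟩
  S * m + 3 * K         ∎)
  where open ≤-Reasoning

dense⇒sparse : ∀ S K m y → 3 ≤ S → m + y ≡ K → (S ∸ 3) * K < S * m → S * y < 3 * K
dense⇒sparse S K m y 3≤S m+y≡K dense = +-cancelˡ-< (S * m) (S * y) (3 * K) (begin-strict
  S * m + S * y         ≡⟨ *-distribˡ-+ S m y ⟨
  S * (m + y)           ≡⟨ cong (S *_) m+y≡K ⟩
  S * K                 ≡⟨ cong (_* K) (m∸n+n≡m 3≤S) ⟨
  (S ∸ 3 + 3) * K       ≡⟨ *-distribʳ-+ K (S ∸ 3) 3 ⟩
  (S ∸ 3) * K + 3 * K   <⟨ +-monoˡ-< (3 * K) dense ⟩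
  S * m + 3 * K         ∎)
  where open ≤-Reasoning

-- Removing e points from the ambient space and at least e points from the set keeps it sparse.
sparse-remove : ∀ S K e x y → 3 ≤ S → x + e ≤ y → S * y < 3 * (K + e) → S * x < 3 * K
sparse-remove S K e x y 3≤S x+e≤y sparse = +-cancelʳ-< (3 * e) (S * x) (3 * K) (begin-strict
  S * x + 3 * e      ≤⟨ +-monoʳ-≤ (S * x) (*-monoˡ-≤ e 3≤S) ⟩
  S * x + S * e      ≡⟨ *-distribˡ-+ S x e ⟨
  S * (x + e)        ≤⟨ *-monoʳ-≤ S x+e≤y ⟩
  S * y              <⟨ sparse ⟩
  3 * (K + e)        ≡⟨ *-distribˡ-+ 3 K e ⟩
  3 * K + 3 * e      ∎)
  where open ≤-Reasoning

-- Every hyperplane misses many points outside M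

module Hyperplane (s : ℕ) (3≤2^s : 3 ≤ 2 ^ s)
  (χ-bound : ∀ (M′ : Matroid) → ¬ Contains M′ (PG s) → (2 ^ s ∸ 3) * 2 ^ rank M′ < 2 ^ s * size M′ →
             ∀ c → IsCriticalNumber M′ c → c ≤ s)
  (M : Matroid) (PG-free : ¬ Contains M (PG (suc s)))
  (sparse : 2 ^ suc s * card (λ v → not (E M v)) < 3 * 2 ^ rank M)
  (χ-large : ∀ c → c ≤ suc s → ¬ AvoidsAtCodim M c)
  (f : V (rank M) → Bool) (f-lin : IsFunctional f) {a : V (rank M)} (fa : f a ≡ true) where

  private
    r : ℕ
    r = rank M

    Y : V r → Bool
    Y v = not (E M v)

    H₁ : V r → Bool
    H₁ v = not (f v)

    H₁-subspace : IsSubspace H₁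
    H₁-subspace = kernel-subspace f f-lin

    2*card-H₁ : 2 * card H₁ ≡ 2 ^ r
    2*card-H₁ = proj₂ (card-functional-half f f-lin fa)

    -- ws: a basis of the span of E(M) ∩ H₁;  us: a complement of it in H₁
    ext-E : Extension (λ v → E M v ∧ H₁ v) []
    ext-E = extend (λ v → E M v ∧ H₁ v) LinIndep-[]

    k : ℕ
    k = Extension.dim ext-E + 0

    ws : Vec (V r) k
    ws = Extension.vectors ext-E ++ᵛ []

    ws-indep : LinIndep ws
    ws-indep = Extension.independent ext-E

    ws⊆E∧H₁ : AllV (λ w → E M w ∧ H₁ w ≡ true) ws
    ws⊆E∧H₁ = AllV.++⁺ (Extension.inside ext-E) []

    ext-H : Extension H₁ ws
    ext-H = extend H₁ ws-indep

    m : ℕ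
    m = Extension.dim ext-H

    us : Vec (V r) m
    us = Extension.vectors ext-H

    Lw : V k → V r
    Lw = lincomb ws

    W : V r → Bool
    W = inSpan ws

    E∧H₁⊆W : ∀ v → E M v ≡ true → H₁ v ≡ true → W v ≡ true
    E∧H₁⊆W v Ev H₁v = Extension.spanning ext-E v (∧-intro Ev H₁v)

    H₁∖W⊆Y : ∀ v → H₁ v ≡ true → W v ≡ false → E M v ≡ false
    H₁∖W⊆Y v H₁v v∉W with E M v in Ev
    ... | false = refl
    ... | true  = trans (sym (E∧H₁⊆W v Ev H₁v)) v∉W

    W⊆H₁ : ∀ v → W v ≡ true → H₁ v ≡ true
    W⊆H₁ v v∈W with inSpan⇒lincomb ws v v∈W
    ... | c , refl = lincomb∈subspace H₁-subspace (AllV.map (proj₂ ∘ ∧-≡true _ _) ws⊆E∧H₁) c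

    span≡H₁ : ∀ v → inSpan (us ++ᵛ ws) v ≡ H₁ v
    span≡H₁ v = Bool-≡ span⊆H₁ (Extension.spanning ext-H v)
      where
      span⊆H₁ : inSpan (us ++ᵛ ws) v ≡ true → H₁ v ≡ true
      span⊆H₁ v∈ with inSpan⇒lincomb (us ++ᵛ ws) v v∈
      ... | c , refl = lincomb∈subspace H₁-subspace
                         (AllV.++⁺ (Extension.inside ext-H) (AllV.map (proj₂ ∘ ∧-≡true _ _) ws⊆E∧H₁)) c

    dim-H₁ : suc (m + k) ≡ r
    dim-H₁ = 2^-injective (begin
      2 * 2 ^ (m + k)                  ≡⟨ cong (2 *_) (card-inSpan (us ++ᵛ ws) (Extension.independent ext-H)) ⟨
      2 * card (inSpan (us ++ᵛ ws))    ≡⟨ cong (2 *_) (card-cong span≡H₁) ⟩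
      2 * card H₁                      ≡⟨ 2*card-H₁ ⟩
      2 ^ r                            ∎)
      where open ≡-Reasoning

    ws⊆E : AllV (λ w → E M w ≡ true) ws
    ws⊆E = AllV.map (proj₁ ∘ ∧-≡true _ _) ws⊆E∧H₁

    M′ : Matroid
    M′ = restrict M ws ws⊆E

    -- Points of H₁ outside W are not in M, so Y loses at least as many points as the ambient space.
    M′-sparse : 2 ^ s * card (λ c → Y (Lw c)) < 3 * 2 ^ k
    M′-sparse = sparse-remove (2 ^ s) (2 ^ k) e _ (card Y) 3≤2^s Y′+e≤Y (subst (λ n → 2 ^ s * card Y < 3 * n) card-H₁ sparse-H₁)
      where
      e : ℕ
      e = card (λ v → H₁ v ∧ not (W v))

      card-H₁ : card H₁ ≡ 2 ^ k + e
      card-H₁ = trans (card-split H₁ W) (cong (_+ e) (trans (card-cong H₁∧W≡W) (card-inSpan ws ws-indep)))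
        where
        H₁∧W≡W : ∀ v → H₁ v ∧ W v ≡ W v
        H₁∧W≡W v = Bool-≡ (proj₂ ∘ ∧-≡true _ _) (λ v∈W → subst (λ b → b ∧ W v ≡ true) (sym (W⊆H₁ v v∈W)) v∈W)

      Y′+e≤Y : card (λ c → Y (Lw c)) + e ≤ card Y
      Y′+e≤Y = subst (card (λ c → Y (Lw c)) + e ≤_) (sym (card-split Y W)) (+-mono-≤
        (card-injection {Q = λ v → Y v ∧ W v} Lw (LinIndep⇒injective ws ws-indep)
          λ c Yc → ∧-intro Yc (inSpan-lincomb ws c))
        (card-mono {P = λ v → H₁ v ∧ not (W v)} {Q = λ v → Y v ∧ not (W v)}
          λ v H₁∖W → let H₁v , v∉W = ∧-≡true (H₁ v) _ H₁∖W in
                     ∧-intro (cong not (H₁∖W⊆Y v H₁v (not-≡true v∉W))) v∉W))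

      sparse-H₁ : 2 ^ s * card Y < 3 * card H₁
      sparse-H₁ = *-cancelˡ-< 2 (2 ^ s * card Y) (3 * card H₁)
        (subst₂ _<_ (*-assoc 2 (2 ^ s) (card Y)) (trans (cong (3 *_) (sym 2*card-H₁)) (*-comm-middle (card H₁))) sparse)
        where
        *-comm-middle : ∀ x → 3 * (2 * x) ≡ 2 * (3 * x)
        *-comm-middle = solve-∀

    M′-dense : (2 ^ s ∸ 3) * 2 ^ rank M′ < 2 ^ s * size M′
    M′-dense = sparse⇒dense (2 ^ s) (2 ^ k) (size M′) _ 3≤2^s (card-complement (λ c → E M (Lw c))) M′-sparse

    -- If M′ contained PG(s-1,2), every coset of it off H₁ would have to meet Y, as M is PG(s,2)-free.
    PG-copy⇒misses : Contains M′ (PG s) → 2 ^ r ≤ 2 ^ suc s * card (λ v → Y v ∧ f v)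
    PG-copy⇒misses copy = begin
      2 ^ r                                    ≡⟨ proj₁ (card-functional-half f f-lin fa) ⟨
      2 * card f                               ≤⟨ *-monoʳ-≤ 2 (card≤length cosets covered) ⟩
      2 * length cosets                        ≡⟨ cong (2 *_) (length-concatMap coset (λ _ → trans (length-map _ (allVecs s)) (length-allVecs s)) (filterᵇ Yf (allVecs r))) ⟩
      2 * (length (filterᵇ Yf (allVecs r)) * 2 ^ s)
                                               ≡⟨ cong (λ n → 2 * (n * 2 ^ s)) (countB≡length-filterᵇ Yf (allVecs r)) ⟨
      2 * (card Yf * 2 ^ s)                    ≡⟨ rearrange (card Yf) (2 ^ s) ⟩
      2 ^ suc s * card Yf                      ∎
      where
      open ≤-Reasoning
      rearrange : ∀ x y → 2 * (x * y) ≡ 2 * y * x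
      rearrange = solve-∀

      F : Contains M (PG s)
      F = Contains-trans {M} {M′} {PG s} (restrict-contained M ws ws⊆E ws-indep) copy

      F⊆H₁ : ∀ u → f (proj₁ F u) ≡ false
      F⊆H₁ u = not-≡true (W⊆H₁ _ (inSpan-lincomb ws (proj₁ copy u)))

      Yf : V r → Bool
      Yf v = Y v ∧ f v

      coset : V r → List (V r)
      coset y = map (λ u → y ⊕ proj₁ F u) (allVecs s)

      cosets : List (V r)
      cosets = concatMap coset (filterᵇ Yf (allVecs r))

      covered : ∀ x → f x ≡ true → x ∈ cosets
      covered x fx with search (λ u → Y (x ⊕ proj₁ F u))
      ... | inj₁ (u , Yy) = ∈-concatMap⁺ coset (lose y∈ x∈coset)
        where
        y : V r
        y = x ⊕ proj₁ F u
        y∈ : y ∈ filterᵇ Yf (allVecs r)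
        y∈ = ∈-filter⁺ (T? ∘ Yf) (∈-allVecs y)
               (Equivalence.from T-≡ (∧-intro Yy (trans (f-lin x _) (cong₂ _xor_ fx (F⊆H₁ u)))))
        x∈coset : x ∈ coset y
        x∈coset = subst (_∈ coset y) (⊕-cancelʳ x (proj₁ F u)) (∈-map⁺ (λ u → y ⊕ proj₁ F u) (∈-allVecs u))
      ... | inj₂ none = ⊥-elim (PG-free (Contains-PG-suc M F x
              (λ u Fu≡x → not-¬ fx (subst (λ w → f w ≡ false) Fu≡x (F⊆H₁ u)))
              (λ u → not-injective (none u))))

    lift : ∀ {c} → AvoidsAtCodim M′ c → AvoidsAtCodim M (suc c)
    lift {c} (K , _ , (e′ , e′+c≡k , dim-K) , K-avoids)
      with lift-avoiding M ws us (Extension.independent ext-H)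
             (λ v Ev v∈ → E∧H₁⊆W v Ev (trans (sym (span≡H₁ v)) v∈)) dim-K K-avoids
    ... | K′ , K′-subspace , dim-K′ , K′-avoids =
      K′ , K′-subspace , (e′ + m , trans (arrange e′ m c) (trans (cong (λ x → suc (m + x)) e′+c≡k) dim-H₁) , dim-K′) , K′-avoids
      where
      arrange : ∀ e′ m c → e′ + m + suc c ≡ suc (m + (e′ + c))
      arrange = solve-∀

  misses : 2 ^ rank M ≤ 2 ^ suc s * card (λ v → Y v ∧ f v)
  misses with 2 ^ rank M ≤? 2 ^ suc s * card (λ v → Y v ∧ f v)
  ... | yes enough = enough
  ... | no too-few = ⊥-elim (¬¬-critical M′ λ (c , critical) →
          χ-large (suc c) (s≤s (χ-bound M′ (too-few ∘ PG-copy⇒misses) M′-dense c critical)) (lift (proj₁ critical)))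

corollary2p2 : (t : ℕ) → 3 ≤ t →
    (∀ (M' : Matroid) → ¬ Contains M' (PG (t ∸ 1)) →
        (2 ^ (t ∸ 1) ∸ 3) * 2 ^ rank M' < 2 ^ (t ∸ 1) * size M' →
        ∀ c → IsCriticalNumber M' c → (c ≡ t ∸ 2) ⊎ (c ≡ t ∸ 1)) →
    (M : Matroid) → ¬ Contains M (PG t) →
    (2 ^ t ∸ 3) * 2 ^ rank M < 2 ^ t * size M →
    (∃ λ c → IsCriticalNumber M c × t < c) →
    ∀ (H : V (rank M) → Bool) → IsSubspace H →
      (HasCodim H 1 → 2 ^ t * card (λ v → not (E M v) ∧ H v) < 2 * 2 ^ rank M)
    × (HasCodim H 2 → 2 * 2 ^ t * card (λ v → not (E M v) ∧ H v) < 3 * 2 ^ rank M)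
    × (HasCodim H 3 → 4 * 2 ^ t * card (λ v → not (E M v) ∧ H v) < 5 * 2 ^ rank M)
-- A HasCodim witness already presents H as a span.
corollary2p2 (suc s) (s≤s 2≤s) hyp M PG-free dense (c₀ , critical , t<c₀) H _ =
  subst (λ n → n * card (λ v → Y v ∧ H v) < 2 * R) (*-identityˡ T) ∘ bound 0 , bound 1 , bound 2
  where
  T R : ℕ
  T = 2 ^ suc s
  R = 2 ^ rank M

  Y : V (rank M) → Bool
  Y v = not (E M v)

  3≤2^s : 3 ≤ 2 ^ s
  3≤2^s = ≤-trans (s≤s (s≤s (s≤s z≤n))) (^-monoʳ-≤ 2 2≤s)

  sparse : T * card Y < 3 * R
  sparse = dense⇒sparse T R (size M) (card Y) (≤-trans 3≤2^s (m≤m+n (2 ^ s) _)) (card-complement (E M)) dense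

  χ-bound : ∀ (M′ : Matroid) → ¬ Contains M′ (PG s) → (2 ^ s ∸ 3) * 2 ^ rank M′ < 2 ^ s * size M′ →
            ∀ c → IsCriticalNumber M′ c → c ≤ s
  χ-bound M′ free dense′ c critical′ with hyp M′ free dense′ c critical′
  ... | inj₁ refl = m∸n≤m s 1
  ... | inj₂ refl = ≤-refl

  χ-large : ∀ c → c ≤ suc s → ¬ AvoidsAtCodim M c
  χ-large c c≤t = proj₂ critical c (≤-<-trans c≤t t<c₀)

  bound : ∀ i → HasCodim H (suc i) → 2 ^ i * T * card (λ v → Y v ∧ H v) < (2 ^ i + 1) * R
  bound = codim-bound Y T R sparse λ f f-lin fa → Hyperplane.misses s 3≤2^s χ-bound M PG-free sparse χ-large f f-lin fa
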